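{- The class of directed-convex polyominoes equals $Av_{\mathfrak{P}}(H,V,D)$, where $H=\left[\begin{array}{ccc}1&0&1\end{array}\right]$, $V=\left[\begin{array}{c}1\\0\\1\end{array}\right]$ and $D=\left[\begin{array}{cc}1&1\\0&1\end{array}\right]$.
   Context: A polyomino is a finite edge-connected union of unit cells, identified with the binary matrix of its minimal bounding rectangle (entry $1$ iff the cell belongs to the polyomino; matrices are displayed with the top row first). It is convex if each row and column is connected. An internal path is a sequence of distinct cells of the polyomino with consecutive cells edge-adjacent, each consecutive pair forming a north, south, east or west step. A polyomino is directed if it has a cell $s$ (the source) such that every cell can be reached from $s$ by an internal path using only north and east steps. A directed-convex polyomino is one that is both directed and convex. $Av_{\mathfrak{P}}(\mathcal{M})$ is the set of polyominoes whose matrix has no submatrix (obtained by deleting rows and/or columns) in $\mathcal{M}$. -}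

module Defs where

open import Data.Bool using (Bool; true; false)
open import Data.Nat using (ℕ; suc)
open import Data.Fin using (Fin; toℕ; _<_; zero)
open import Data.Fin.Patterns using (0F; 1F; 2F)
open import Data.Product using (Σ; ∃; ∃-syntax; _×_; _,_)
open import Data.Sum using (_⊎_)
open import Relation.Nullary using (¬_)
open import Relation.Binary.PropositionalEquality using (_≡_)
open import Relation.Binary.Construct.Closure.ReflexiveTransitive using (Star)

-- A binary matrix with m rows and n columns; row 0 is the TOP row,
-- column 0 is the LEFT column.  Entry true = the cell belongs.
BMat : ℕ → ℕ → Set
BMat m n = Fin m → Fin n → Bool

Pos : ℕ → ℕ → Set
Pos m n = Fin m × Fin n

module _ {m n : ℕ} (M : BMat m n) where

  Cell : Pos m n → Set
  Cell (i , j) = M i j ≡ true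

  NorthStep : Pos m n → Pos m n → Set
  NorthStep (i , j) (i' , j') = (toℕ i ≡ suc (toℕ i')) × (j ≡ j')

  EastStep : Pos m n → Pos m n → Set
  EastStep (i , j) (i' , j') = (i ≡ i') × (toℕ j' ≡ suc (toℕ j))

  AdjStep : Pos m n → Pos m n → Set
  AdjStep a b = Cell a × Cell b ×
    (NorthStep a b ⊎ NorthStep b a ⊎ EastStep a b ⊎ EastStep b a)

  NEStep : Pos m n → Pos m n → Set
  NEStep a b = Cell a × Cell b × (NorthStep a b ⊎ EastStep a b)

  Connected : Set
  Connected = ∀ a b → Cell a → Cell b → Star AdjStep a b

  -- M is the matrix of a polyomino on its minimal bounding rectangle:
  -- nonempty, edge-connected, and every row and every column meets it
  IsPolyomino : Set
  IsPolyomino = (∃[ a ] Cell a)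
              × Connected
              × (∀ i → ∃[ j ] M i j ≡ true)
              × (∀ j → ∃[ i ] M i j ≡ true)

  Convex : Set
  Convex = (∀ i j₁ j j₂ → M i j₁ ≡ true → M i j₂ ≡ true →
              toℕ j₁ Data.Nat.≤ toℕ j → toℕ j Data.Nat.≤ toℕ j₂ → M i j ≡ true)
         × (∀ j i₁ i i₂ → M i₁ j ≡ true → M i₂ j ≡ true →
              toℕ i₁ Data.Nat.≤ toℕ i → toℕ i Data.Nat.≤ toℕ i₂ → M i j ≡ true)

  Directed : Set
  Directed = ∃[ s ] (Cell s × (∀ c → Cell c → Star NEStep s c))

  DirectedConvex : Set
  DirectedConvex = Directed × Convex

record Occurs {k l m n : ℕ} (P : BMat k l) (M : BMat m n) : Set where
  field
    rows     : Fin k → Fin m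
    cols     : Fin l → Fin n
    rowsMono : ∀ i i' → i < i' → rows i < rows i'
    colsMono : ∀ j j' → j < j' → cols j < cols j'
    match    : ∀ i j → M (rows i) (cols j) ≡ P i j

Avoids : {k l m n : ℕ} → BMat k l → BMat m n → Set
Avoids P M = ¬ Occurs P M

H : BMat 1 3
H _ 0F = true
H _ 1F = false
H _ 2F = true

V : BMat 3 1
V 0F _ = true
V 1F _ = false
V 2F _ = true

D : BMat 2 2
D 0F _  = true
D 1F 0F = false
D 1F 1F = true

AvHVD : {m n : ℕ} → BMat m n → Set
AvHVD M = Avoids H M × Avoids V M × Avoids D M

module Submission where

-- Convexity of rows (of columns) is literally the avoidance of H (of V),
-- so the content is that a convex polyomino is directed iff it avoids D.
--
-- (⇒) North-east paths move weakly up and right.  If D occupied rows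
-- r₀ < r₁ and columns c₀ < c₁, the source would lie in a row ≥ r₁ (it
-- reaches the cell (r₁,c₁)), so its path to (r₀,c₀) leaves the rows ≥ r₁
-- by a north step out of row r₁ at a column ≤ c₀; row convexity then
-- fills the entry (r₁,c₀), which D requires to be 0.
--
-- (⇐) The source is the bottom-left corner.  A cell without a cell below
-- it and without a cell to its left is, by convexity, lowest in its
-- column and leftmost in its row; connectivity and the avoidance of D
-- force such a cell to be the bottom-left corner.  Every other cell thus
-- has a south or west neighbour closer to the corner, and descent on this
-- distance builds the north-east paths.

open import Defs
open import Data.Bool using (Bool; true; false)
open import Data.Bool.Properties using (¬-not)
open import Data.Empty using (⊥; ⊥-elim)
open import Data.Fin using (Fin; toℕ; fromℕ; fromℕ<; inject₁)
  renaming (zero to fzero; suc to fsuc)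
open import Data.Fin.Patterns using (0F; 1F; 2F)
open import Data.Fin.Properties using (toℕ-injective; toℕ<n; toℕ-fromℕ; toℕ-fromℕ<; toℕ-inject₁)
open import Data.Nat using (ℕ; zero; suc; _≤_; _<_; _∸_; _+_; _≤?_; _<?_; z≤n; s≤s)
open import Data.Nat.Induction using (<-wellFounded)
open import Data.Nat.Properties
  using (≤-refl; ≤-trans; ≤-reflexive; ≤-antisym; ≤-pred; <-trans; <⇒≤; <⇒≱; ≰⇒>; ≮⇒≥;
         ≤∧≢⇒<; n≤1+n; suc-injective; +-monoˡ-<; +-monoʳ-<; ∸-monoʳ-<)
open import Data.Product using (∃; ∃₂; _×_; _,_; proj₁; proj₂)
open import Data.Sum using (_⊎_; inj₁; inj₂)
open import Data.Vec using ([]; _∷_; lookup)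
open import Function.Bundles using (_⇔_; mk⇔)
open import Induction.WellFounded using (Acc; acc)
open import Relation.Binary.Construct.Closure.ReflexiveTransitive using (Star; ε; _◅_; _◅◅_; fold)
open import Relation.Binary.PropositionalEquality
  using (_≡_; _≢_; refl; sym; trans; cong; cong₂; subst)
open import Relation.Nullary using (¬_; yes; no)
open import Relation.Unary using (Decidable)

module _ {A : Set} {R : A → A → Set} where

  exitStep : {P : A → Set} → Decidable P → ∀ {a b} → Star R a b → P a → ¬ P b →
             ∃₂ λ x y → P x × ¬ P y × R x y × Star R y b
  exitStep P? ε pa ¬pb = ⊥-elim (¬pb pa)
  exitStep P? (_◅_ {j = y} step rest) pa ¬pb with P? y
  ... | yes py = exitStep P? rest py ¬pb
  ... | no ¬py = _ , y , pa , ¬py , step , rest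

  reachByDescent : (Q : A → Set) (μ : A → ℕ) (s : A) →
                   (∀ a → Q a → a ≡ s ⊎ ∃ λ p → Q p × R p a × μ p < μ a) →
                   ∀ a → Q a → Star R s a
  reachByDescent Q μ s predecessor a qa = go a qa (<-wellFounded (μ a))
    where
      go : ∀ a → Q a → Acc _<_ (μ a) → Star R s a
      go a qa (acc smaller) with predecessor a qa
      ... | inj₁ refl = ε
      ... | inj₂ (p , qp , step , μp<μa) = go p qp (smaller μp<μa) ◅◅ (step ◅ ε)

entryClash : ∀ {b : Bool} → b ≡ true → b ≡ false → ⊥
entryClash refl ()

valuesSeparate : ∀ {N} (f : Fin N → Bool) {x y} → f x ≡ true → f y ≡ false → toℕ x ≢ toℕ y
valuesSeparate f fx fy x≡y = entryClash (trans (cong f (sym (toℕ-injective x≡y))) fx) fy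

<-fromTrueFalse : ∀ {N} (f : Fin N → Bool) {x y} → toℕ x ≤ toℕ y →
                  f x ≡ true → f y ≡ false → toℕ x < toℕ y
<-fromTrueFalse f x≤y fx fy = ≤∧≢⇒< x≤y (valuesSeparate f fx fy)

<-fromFalseTrue : ∀ {N} (f : Fin N → Bool) {x y} → toℕ x ≤ toℕ y →
                  f x ≡ false → f y ≡ true → toℕ x < toℕ y
<-fromFalseTrue f x≤y fx fy = ≤∧≢⇒< x≤y (λ x≡y → valuesSeparate f fy fx (sym x≡y))

lastOrNext : ∀ {N} (i : Fin N) → (∀ k → toℕ k ≤ toℕ i) ⊎ ∃ λ (i₁ : Fin N) → toℕ i₁ ≡ suc (toℕ i)
lastOrNext {N} i with suc (toℕ i) <? N
... | yes notLast = inj₂ (fromℕ< notLast , toℕ-fromℕ< notLast)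
... | no last = inj₁ (λ k → ≤-pred (≤-trans (toℕ<n k) (≮⇒≥ last)))

firstOrPrevious : ∀ {N} (j : Fin N) → toℕ j ≡ 0 ⊎ ∃ λ (j₀ : Fin N) → toℕ j ≡ suc (toℕ j₀)
firstOrPrevious fzero = inj₁ refl
firstOrPrevious (fsuc j) = inj₂ (inject₁ j , cong suc (sym (toℕ-inject₁ j)))

increasing₁ : ∀ {N} {a : Fin N} x y → toℕ x < toℕ y →
              toℕ (lookup (a ∷ []) x) < toℕ (lookup (a ∷ []) y)
increasing₁ 0F 0F ()

increasing₂ : ∀ {N} {a b : Fin N} → toℕ a < toℕ b → ∀ x y → toℕ x < toℕ y →
              toℕ (lookup (a ∷ b ∷ []) x) < toℕ (lookup (a ∷ b ∷ []) y)
increasing₂ a<b 0F 1F _ = a<b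
increasing₂ _ 0F 0F ()
increasing₂ _ 1F 0F ()
increasing₂ _ 1F 1F (s≤s ())

increasing₃ : ∀ {N} {a b c : Fin N} → toℕ a < toℕ b → toℕ b < toℕ c → ∀ x y → toℕ x < toℕ y →
              toℕ (lookup (a ∷ b ∷ c ∷ []) x) < toℕ (lookup (a ∷ b ∷ c ∷ []) y)
increasing₃ a<b _ 0F 1F _ = a<b
increasing₃ a<b b<c 0F 2F _ = <-trans a<b b<c
increasing₃ _ b<c 1F 2F _ = b<c
increasing₃ _ _ 0F 0F ()
increasing₃ _ _ 1F 0F ()
increasing₃ _ _ 1F 1F (s≤s ())
increasing₃ _ _ 2F 0F ()
increasing₃ _ _ 2F 1F (s≤s ())
increasing₃ _ _ 2F 2F (s≤s (s≤s ()))

RowConvex : ∀ {m n} → BMat m n → Set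
RowConvex M = ∀ i j₁ j j₂ → M i j₁ ≡ true → M i j₂ ≡ true →
              toℕ j₁ ≤ toℕ j → toℕ j ≤ toℕ j₂ → M i j ≡ true

ColumnConvex : ∀ {m n} → BMat m n → Set
ColumnConvex M = ∀ j i₁ i i₂ → M i₁ j ≡ true → M i₂ j ≡ true →
                 toℕ i₁ ≤ toℕ i → toℕ i ≤ toℕ i₂ → M i j ≡ true

-- b lies weakly north-east of a (row indices grow downwards).
_≼_ : ∀ {m n} → Pos m n → Pos m n → Set
(ai , aj) ≼ (bi , bj) = toℕ bi ≤ toℕ ai × toℕ aj ≤ toℕ bj

≼-refl : ∀ {m n} {a : Pos m n} → a ≼ a
≼-refl {a = _ , _} = ≤-refl , ≤-refl

module _ {m n : ℕ} (M : BMat m n) where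

  occursH : ∀ i {j₁ j j₂} → toℕ j₁ < toℕ j → toℕ j < toℕ j₂ →
            M i j₁ ≡ true → M i j ≡ false → M i j₂ ≡ true → Occurs H M
  occursH i {j₁} {j} {j₂} j₁<j j<j₂ e₁ e e₂ = record
    { rows = lookup (i ∷ []) ; cols = lookup (j₁ ∷ j ∷ j₂ ∷ [])
    ; rowsMono = increasing₁ ; colsMono = increasing₃ j₁<j j<j₂ ; match = entries }
    where
      entries : ∀ x y → M (lookup (i ∷ []) x) (lookup (j₁ ∷ j ∷ j₂ ∷ []) y) ≡ H x y
      entries 0F 0F = e₁
      entries 0F 1F = e
      entries 0F 2F = e₂

  occursV : ∀ j {i₁ i i₂} → toℕ i₁ < toℕ i → toℕ i < toℕ i₂ →
            M i₁ j ≡ true → M i j ≡ false → M i₂ j ≡ true → Occurs V M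
  occursV j {i₁} {i} {i₂} i₁<i i<i₂ e₁ e e₂ = record
    { rows = lookup (i₁ ∷ i ∷ i₂ ∷ []) ; cols = lookup (j ∷ [])
    ; rowsMono = increasing₃ i₁<i i<i₂ ; colsMono = increasing₁ ; match = entries }
    where
      entries : ∀ x y → M (lookup (i₁ ∷ i ∷ i₂ ∷ []) x) (lookup (j ∷ []) y) ≡ V x y
      entries 0F 0F = e₁
      entries 1F 0F = e
      entries 2F 0F = e₂

  occursD : ∀ {r₀ r₁ c₀ c₁} → toℕ r₀ < toℕ r₁ → toℕ c₀ < toℕ c₁ →
            M r₀ c₀ ≡ true → M r₀ c₁ ≡ true → M r₁ c₀ ≡ false → M r₁ c₁ ≡ true → Occurs D M
  occursD {r₀} {r₁} {c₀} {c₁} r₀<r₁ c₀<c₁ e₀₀ e₀₁ e₁₀ e₁₁ = record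
    { rows = lookup (r₀ ∷ r₁ ∷ []) ; cols = lookup (c₀ ∷ c₁ ∷ [])
    ; rowsMono = increasing₂ r₀<r₁ ; colsMono = increasing₂ c₀<c₁ ; match = entries }
    where
      entries : ∀ x y → M (lookup (r₀ ∷ r₁ ∷ []) x) (lookup (c₀ ∷ c₁ ∷ []) y) ≡ D x y
      entries 0F 0F = e₀₀
      entries 0F 1F = e₀₁
      entries 1F 0F = e₁₀
      entries 1F 1F = e₁₁

  rowConvex⇒avoidsH : RowConvex M → Avoids H M
  rowConvex⇒avoidsH convex occ = entryClash filled (match 0F 1F)
    where
      open Occurs occ
      filled : M (rows 0F) (cols 1F) ≡ true
      filled = convex (rows 0F) (cols 0F) (cols 1F) (cols 2F) (match 0F 0F) (match 0F 2F)
                 (<⇒≤ (colsMono 0F 1F (s≤s z≤n))) (<⇒≤ (colsMono 1F 2F (s≤s (s≤s z≤n))))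

  columnConvex⇒avoidsV : ColumnConvex M → Avoids V M
  columnConvex⇒avoidsV convex occ = entryClash filled (match 1F 0F)
    where
      open Occurs occ
      filled : M (rows 1F) (cols 0F) ≡ true
      filled = convex (cols 0F) (rows 0F) (rows 1F) (rows 2F) (match 0F 0F) (match 2F 0F)
                 (<⇒≤ (rowsMono 0F 1F (s≤s z≤n))) (<⇒≤ (rowsMono 1F 2F (s≤s (s≤s z≤n))))

  avoidsH⇒rowConvex : Avoids H M → RowConvex M
  avoidsH⇒rowConvex avoids i j₁ j j₂ e₁ e₂ j₁≤j j≤j₂ with M i j in e
  ... | true = refl
  ... | false = ⊥-elim (avoids (occursH i (<-fromTrueFalse (M i) j₁≤j e₁ e)
                                          (<-fromFalseTrue (M i) j≤j₂ e e₂) e₁ e e₂))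

  avoidsV⇒columnConvex : Avoids V M → ColumnConvex M
  avoidsV⇒columnConvex avoids j i₁ i i₂ e₁ e₂ i₁≤i i≤i₂ with M i j in e
  ... | true = refl
  ... | false = ⊥-elim (avoids (occursV j (<-fromTrueFalse (λ r → M r j) i₁≤i e₁ e)
                                          (<-fromFalseTrue (λ r → M r j) i≤i₂ e e₂) e₁ e e₂))

  neStep-≼ : ∀ {a x b} → NEStep M a x → x ≼ b → a ≼ b
  neStep-≼ {_ , _} {_ , _} {_ , _} (_ , _ , inj₁ (up , refl)) (b≤x , a≤b) =
    ≤-trans b≤x (≤-trans (n≤1+n _) (≤-reflexive (sym up))) , a≤b
  neStep-≼ {_ , _} {_ , _} {_ , _} (_ , _ , inj₂ (refl , right)) (b≤a , x≤b) =
    b≤a , ≤-trans (≤-trans (n≤1+n _) (≤-reflexive (sym right))) x≤b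

  nePath-≼ : ∀ {a b} → Star (NEStep M) a b → a ≼ b
  nePath-≼ = fold _≼_ neStep-≼ ≼-refl

  crossRowUpward : ∀ r {a b} → Star (NEStep M) a b →
                   toℕ r ≤ toℕ (proj₁ a) → toℕ (proj₁ b) < toℕ r →
                   ∃ λ k → M r k ≡ true × toℕ k ≤ toℕ (proj₂ b)
  crossRowUpward r path r≤a b<r
    with exitStep (λ p → toℕ r ≤? toℕ (proj₁ p)) path r≤a (<⇒≱ b<r)
  ... | _ , _ , r≤x , r≰y , (_ , _ , inj₂ (refl , _)) , _ = ⊥-elim (r≰y r≤x)
  ... | (xi , xj) , _ , r≤x , r≰y , (cellₓ , _ , inj₁ (up , refl)) , rest =
        xj , subst (λ i → M i xj ≡ true) x≡r cellₓ , proj₂ (nePath-≼ rest)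
    where
      x≡r : xi ≡ r
      x≡r = toℕ-injective (≤-antisym (≤-trans (≤-reflexive up) (≰⇒> r≰y)) r≤x)

  directed⇒avoidsD : Directed M → RowConvex M → Avoids D M
  directed⇒avoidsD (s , _ , reach) convex occ = entryClash filled (match 1F 0F)
    where
      open Occurs occ
      sourceBelow : toℕ (rows 1F) ≤ toℕ (proj₁ s)
      sourceBelow = proj₁ (nePath-≼ (reach (rows 1F , cols 1F) (match 1F 1F)))
      filled : M (rows 1F) (cols 0F) ≡ true
      filled with crossRowUpward (rows 1F) (reach (rows 0F , cols 0F) (match 0F 0F))
                                 sourceBelow (rowsMono 0F 1F (s≤s z≤n))
      ... | k , cellₖ , k≤c₀ = convex (rows 1F) k (cols 0F) (cols 1F) cellₖ (match 1F 1F)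
                                 k≤c₀ (<⇒≤ (colsMono 0F 1F (s≤s z≤n)))

  directedConvex⇒avoidsHVD : DirectedConvex M → AvHVD M
  directedConvex⇒avoidsHVD (directed , rowConvex , columnConvex) =
    rowConvex⇒avoidsH rowConvex , columnConvex⇒avoidsV columnConvex ,
    directed⇒avoidsD directed rowConvex

  downwardStep : ∀ {i : Fin m} {xi xj yi yj} → AdjStep M (xi , xj) (yi , yj) →
                 toℕ xi ≤ toℕ i → toℕ i < toℕ yi → toℕ yi ≡ suc (toℕ xi) × xj ≡ yj
  downwardStep (_ , _ , inj₁ (up , _)) x≤i i<y =
    ⊥-elim (<⇒≱ i<y (≤-trans (≤-trans (n≤1+n _) (≤-reflexive (sym up))) x≤i))
  downwardStep (_ , _ , inj₂ (inj₁ (down , refl))) _ _ = down , refl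
  downwardStep (_ , _ , inj₂ (inj₂ (inj₁ (refl , _)))) x≤i i<y = ⊥-elim (<⇒≱ i<y x≤i)
  downwardStep (_ , _ , inj₂ (inj₂ (inj₂ (refl , _)))) x≤i i<y = ⊥-elim (<⇒≱ i<y x≤i)

  leftwardStep : ∀ {j : Fin n} {xi xj yi yj} → AdjStep M (xi , xj) (yi , yj) →
                 toℕ j ≤ toℕ xj → toℕ yj < toℕ j → toℕ xj ≡ suc (toℕ yj) × xi ≡ yi
  leftwardStep (_ , _ , inj₁ (_ , refl)) j≤x y<j = ⊥-elim (<⇒≱ y<j j≤x)
  leftwardStep (_ , _ , inj₂ (inj₁ (_ , refl))) j≤x y<j = ⊥-elim (<⇒≱ y<j j≤x)
  leftwardStep (_ , _ , inj₂ (inj₂ (inj₁ (refl , right)))) j≤x y<j =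
    ⊥-elim (<⇒≱ y<j (≤-trans j≤x (≤-trans (n≤1+n _) (≤-reflexive (sym right)))))
  leftwardStep (_ , _ , inj₂ (inj₂ (inj₂ (refl , left)))) _ _ = left , refl

  crossRowDownward : ∀ {i i₁} → toℕ i₁ ≡ suc (toℕ i) → ∀ {a b} → Star (AdjStep M) a b →
                     toℕ (proj₁ a) ≤ toℕ i → toℕ i < toℕ (proj₁ b) →
                     ∃ λ k → M i k ≡ true × M i₁ k ≡ true
  crossRowDownward {i} {i₁} next path a≤i i<b
    with exitStep (λ p → toℕ (proj₁ p) ≤? toℕ i) path a≤i (<⇒≱ i<b)
  ... | (xi , xj) , (yi , _) , x≤i , y≰i , step@(cellₓ , cellᵧ , _) , _
    with downwardStep step x≤i (≰⇒> y≰i)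
  ... | down , refl =
        xj , subst (λ r → M r xj ≡ true) x≡i cellₓ , subst (λ r → M r xj ≡ true) y≡i₁ cellᵧ
    where
      x≡i : xi ≡ i
      x≡i = toℕ-injective (≤-antisym x≤i (≤-pred (≤-trans (≰⇒> y≰i) (≤-reflexive down))))
      y≡i₁ : yi ≡ i₁
      y≡i₁ = toℕ-injective (trans down (trans (cong (λ r → suc (toℕ r)) x≡i) (sym next)))

  crossColumnLeftward : ∀ {j j₀} → toℕ j ≡ suc (toℕ j₀) → ∀ {a b} → Star (AdjStep M) a b →
                        toℕ j ≤ toℕ (proj₂ a) → toℕ (proj₂ b) < toℕ j →
                        ∃ λ k → M k j ≡ true × M k j₀ ≡ true
  crossColumnLeftward {j} {j₀} previous path j≤a b<j
    with exitStep (λ p → toℕ j ≤? toℕ (proj₂ p)) path j≤a (<⇒≱ b<j)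
  ... | (xi , xj) , (_ , yj) , j≤x , j≰y , step@(cellₓ , cellᵧ , _) , _
    with leftwardStep step j≤x (≰⇒> j≰y)
  ... | left , refl =
        xi , subst (λ c → M xi c ≡ true) x≡j cellₓ , subst (λ c → M xi c ≡ true) y≡j₀ cellᵧ
    where
      x≡j : xj ≡ j
      x≡j = toℕ-injective (≤-antisym (≤-trans (≤-reflexive left) (≰⇒> j≰y)) j≤x)
      y≡j₀ : yj ≡ j₀
      y≡j₀ = toℕ-injective (suc-injective (trans (sym left) (trans (cong toℕ x≡j) previous)))

  LowestInColumn : Fin m → Fin n → Set
  LowestInColumn i j = ∀ k → M k j ≡ true → toℕ k ≤ toℕ i

  LeftmostInRow : Fin m → Fin n → Set
  LeftmostInRow i j = ∀ k → M i k ≡ true → toℕ j ≤ toℕ k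

  belowOrLowest : ColumnConvex M → ∀ {i j} → M i j ≡ true →
                  (∃ λ i₁ → toℕ i₁ ≡ suc (toℕ i) × M i₁ j ≡ true) ⊎ LowestInColumn i j
  belowOrLowest convex {i} {j} cell with lastOrNext i
  ... | inj₁ last = inj₂ (λ k _ → last k)
  ... | inj₂ (i₁ , next) with M i₁ j in below
  ...   | true = inj₁ (i₁ , next , below)
  ...   | false = inj₂ lowest
    where
      lowest : LowestInColumn i j
      lowest k cellₖ with toℕ k ≤? toℕ i
      ... | yes k≤i = k≤i
      ... | no k≰i = ⊥-elim (entryClash (convex j i i₁ k cell cellₖ
                       (≤-trans (n≤1+n _) (≤-reflexive (sym next)))
                       (≤-trans (≤-reflexive next) (≰⇒> k≰i))) below)

  leftOrLeftmost : RowConvex M → ∀ {i j} → M i j ≡ true →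
                   (∃ λ j₀ → toℕ j ≡ suc (toℕ j₀) × M i j₀ ≡ true) ⊎ LeftmostInRow i j
  leftOrLeftmost convex {i} {j} cell with firstOrPrevious j
  ... | inj₁ first = inj₂ (λ k _ → subst (_≤ toℕ k) (sym first) z≤n)
  ... | inj₂ (j₀ , previous) with M i j₀ in left
  ...   | true = inj₁ (j₀ , previous , left)
  ...   | false = inj₂ leftmost
    where
      leftmost : LeftmostInRow i j
      leftmost k cellₖ with toℕ j ≤? toℕ k
      ... | yes j≤k = j≤k
      ... | no j≰k = ⊥-elim (entryClash (convex i k j₀ j cellₖ cell
                       (≤-pred (≤-trans (≰⇒> j≰k) (≤-reflexive previous)))
                       (≤-trans (n≤1+n _) (≤-reflexive (sym previous)))) left)

  -- A cell lowest in its column and leftmost in its row lies in the bottom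
  -- row: otherwise a path into the next row crosses it at a column k right
  -- of j, and rows i, i+1 with columns j, k carry D.
  cornerInBottomRow : Connected M → (∀ i → ∃ λ j → M i j ≡ true) → Avoids D M →
                      ∀ {i j} → M i j ≡ true → LowestInColumn i j → LeftmostInRow i j →
                      ∀ k → toℕ k ≤ toℕ i
  cornerInBottomRow connected rowsMeet avoidsD {i} {j} cell lowest leftmost with lastOrNext i
  ... | inj₁ last = last
  ... | inj₂ (i₁ , next) with rowsMeet i₁
  ...   | k₀ , cellₖ₀
    with crossRowDownward next (connected (i , j) (i₁ , k₀) cell cellₖ₀) ≤-refl (≤-reflexive (sym next))
  ...     | k , upper , lower =
            ⊥-elim (avoidsD (occursD (≤-reflexive (sym next)) j<k cell upper belowEmpty lower))
    where
      belowEmpty : M i₁ j ≡ false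
      belowEmpty = ¬-not {y = true} (λ filled → <⇒≱ (≤-reflexive (sym next)) (lowest i₁ filled))
      j<k : toℕ j < toℕ k
      j<k = <-fromFalseTrue (M i₁) (leftmost k upper) belowEmpty lower

  -- Symmetrically, such a cell lies in the first column: otherwise a path
  -- into the previous column crosses it at a row k above i, and rows k, i
  -- with columns j-1, j carry D.
  cornerInFirstColumn : Connected M → (∀ j → ∃ λ i → M i j ≡ true) → Avoids D M →
                        ∀ {i j} → M i j ≡ true → LowestInColumn i j → LeftmostInRow i j →
                        toℕ j ≡ 0
  cornerInFirstColumn connected columnsMeet avoidsD {i} {j} cell lowest leftmost
    with firstOrPrevious j
  ... | inj₁ first = first
  ... | inj₂ (j₀ , previous) with columnsMeet j₀
  ...   | k₀ , cellₖ₀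
    with crossColumnLeftward previous (connected (i , j) (k₀ , j₀) cell cellₖ₀) ≤-refl
                             (≤-reflexive (sym previous))
  ...     | k , right , left =
            ⊥-elim (avoidsD (occursD k<i (≤-reflexive (sym previous)) left right leftEmpty cell))
    where
      leftEmpty : M i j₀ ≡ false
      leftEmpty = ¬-not {y = true} (λ filled → <⇒≱ (≤-reflexive (sym previous)) (leftmost j₀ filled))
      k<i : toℕ k < toℕ i
      k<i = <-fromTrueFalse (λ r → M r j₀) (lowest k right) left leftEmpty

startIsCell : ∀ {m n} {M : BMat m n} {s a} → Star (NEStep M) s a → Cell M a → Cell M s
startIsCell ε cell = cell
startIsCell ((cellₛ , _) ◅ _) _ = cellₛ

module _ {m' n' : ℕ} (M : BMat (suc m') (suc n')) where

  corner : Pos (suc m') (suc n')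
  corner = fromℕ m' , fzero

  distance : Pos (suc m') (suc n') → ℕ
  distance (i , j) = (m' ∸ toℕ i) + toℕ j

  nePredecessor : IsPolyomino M → Convex M → Avoids D M → ∀ c → Cell M c →
                  c ≡ corner ⊎ ∃ λ p → Cell M p × NEStep M p c × distance p < distance c
  nePredecessor (_ , connected , rowsMeet , columnsMeet) (rowConvex , columnConvex) avoidsD
                (i , j) cell with belowOrLowest M columnConvex cell
  ... | inj₁ (i₁ , next , below) =
        inj₂ ((i₁ , j) , below , (below , cell , inj₁ (next , refl)) ,
              +-monoˡ-< (toℕ j) (∸-monoʳ-< (≤-reflexive (sym next)) (≤-pred (toℕ<n i₁))))
  ... | inj₂ lowest with leftOrLeftmost M rowConvex cell
  ...   | inj₁ (j₀ , previous , left) =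
          inj₂ ((i , j₀) , left , (left , cell , inj₂ (refl , previous)) ,
                +-monoʳ-< (m' ∸ toℕ i) (≤-reflexive (sym previous)))
  ...   | inj₂ leftmost = inj₁ (cong₂ _,_ (toℕ-injective i≡m') (toℕ-injective j≡0))
    where
      bottom : ∀ k → toℕ k ≤ toℕ i
      bottom = cornerInBottomRow M connected rowsMeet avoidsD cell lowest leftmost
      i≡m' : toℕ i ≡ toℕ (fromℕ m')
      i≡m' = ≤-antisym (≤-trans (≤-pred (toℕ<n i)) (≤-reflexive (sym (toℕ-fromℕ m'))))
                       (bottom (fromℕ m'))
      j≡0 : toℕ j ≡ 0
      j≡0 = cornerInFirstColumn M connected columnsMeet avoidsD cell lowest leftmost

  cornerIsSource : IsPolyomino M → Convex M → Avoids D M → Directed M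
  cornerIsSource polyomino convex avoidsD =
    corner , startIsCell (reachAll a cellₐ) cellₐ , reachAll
    where
      a = proj₁ (proj₁ polyomino)
      cellₐ = proj₂ (proj₁ polyomino)
      reachAll : ∀ c → Cell M c → Star (NEStep M) corner c
      reachAll = reachByDescent (Cell M) distance corner (nePredecessor polyomino convex avoidsD)

avoidsHVD⇒directedConvex : ∀ {m n} (M : BMat m n) → IsPolyomino M → AvHVD M → DirectedConvex M
avoidsHVD⇒directedConvex {zero} M (((() , _) , _) , _) _
avoidsHVD⇒directedConvex {suc _} {zero} M (((_ , ()) , _) , _) _
avoidsHVD⇒directedConvex {suc _} {suc _} M polyomino (avoidsH , avoidsV , avoidsD) =
  cornerIsSource M polyomino convex avoidsD , convex
  where
    convex : Convex M
    convex = avoidsH⇒rowConvex M avoidsH , avoidsV⇒columnConvex M avoidsV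

mainTheorem17 : (m n : ℕ) (M : BMat m n) → IsPolyomino M →
    (DirectedConvex M ⇔ AvHVD M)
mainTheorem17 m n M polyomino =
  mk⇔ (directedConvex⇒avoidsHVD M) (avoidsHVD⇒directedConvex M polyomino)
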